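{- Let $p$ be a positive integer and $n$ a positive integer. The set of $p$-Fibonacci polyominoes of area $n$ is in bijection with the set of compositions of $n$ all of whose parts lie in the set \[A_p=\left\{\tfrac12(p+i)(p-i+1):\ 1\le i\le p\right\}.\]
   Context: A $p$-Fibonacci word of length $n\ge 1$ is a word $u=u_1u_2\cdots u_n$ over $\{1,\dots,p\}$ with $u_1=p$ and, for $1\le i\le n-1$: if $u_i=1$ then $u_{i+1}=p$; if $2\le u_i\le p$ then $u_{i+1}\in\{u_i-1,\,p\}$. Each such word determines a polyomino (bargraph): $n$ adjacent columns of unit square cells resting on a common horizontal base line, the $i$-th column having $u_i$ cells; these are the $p$-Fibonacci polyominoes. The area of such a polyomino is its number of cells, i.e. $u_1+\cdots+u_n$. A composition of $n$ is a finite sequence of positive integers (parts) $(\sigma_1,\dots,\sigma_\ell)$ with $\sigma_1+\cdots+\sigma_\ell=n$. -}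

module Defs where

open import Data.Nat using (ℕ; zero; suc; _+_; _*_; _∸_; _≤_)
open import Data.List using (List; []; _∷_)
open import Data.Nat.ListAction using (sum)
open import Data.List.Relation.Unary.All using (All)
open import Data.Product using (Σ; _×_; ∃-syntax)
open import Data.Sum using (_⊎_)
open import Relation.Binary.PropositionalEquality using (_≡_)

data Step (p : ℕ) : ℕ → ℕ → Set where
  down  : ∀ {a} → 2 ≤ a → a ≤ p → Step p a (a ∸ 1)
  reset : ∀ {a} → 1 ≤ a → a ≤ p → Step p a p

data Chain (p : ℕ) : List ℕ → Set where
  single : ∀ {a} → Chain p (a ∷ [])
  cons   : ∀ {a b w} → Step p a b → Chain p (b ∷ w) → Chain p (a ∷ b ∷ w)

data PFib (p : ℕ) : List ℕ → Set where
  pfib : ∀ {w} → Chain p (p ∷ w) → PFib p (p ∷ w)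

-- The p-Fibonacci polyominoes of area n: words u (the column heights) that
-- are p-Fibonacci words with u₁ + ⋯ + uₙ = n.
PFibPolyomino : ℕ → ℕ → Set
PFibPolyomino p n = Σ (List ℕ) λ u → PFib p u × sum u ≡ n

-- Membership in A_p = { (p+i)(p-i+1)/2 : 1 ≤ i ≤ p }, written without
-- division: 2a = (p+i)(p-i+1).
InA : ℕ → ℕ → Set
InA p a = ∃[ i ] (1 ≤ i × i ≤ p × 2 * a ≡ (p + i) * (p + 1 ∸ i))

Composition : ℕ → Set
Composition n = Σ (List ℕ) λ σ → All (1 ≤_) σ × sum σ ≡ n

APComposition : ℕ → ℕ → Set
APComposition p n = Σ (List ℕ) λ σ → (All (1 ≤_) σ × All (InA p) σ) × sum σ ≡ n

-- A p-Fibonacci word is, uniquely, a concatenation of blocks p, p ∸ 1, …, p ∸ k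
-- with k < p, since a new block starts exactly at each letter p.  The block of
-- depth k has area (p + i)(p + 1 − i)/2 for i = p ∸ k (a Gauss sum), and block
-- areas strictly increase with the depth, so every element of A_p is the area
-- of exactly one block.  Replacing each block by its area is therefore a
-- bijection between p-Fibonacci words and A_p-compositions, preserving area.
module Submission where

open import Defs
open import Data.Nat using (ℕ; zero; suc; _+_; _*_; _∸_; _≤_; _<_; z≤n; s≤s; _≟_)
open import Data.Nat.Properties
open import Data.Nat.ListAction using (sum)
open import Data.Nat.ListAction.Properties using (sum-++)
open import Data.Nat.Tactic.RingSolver using (solve-∀)
open import Data.List using (List; []; _∷_; [_]; _++_; _∷ʳ_; map; concatMap; applyUpTo; length)
open import Data.List.Properties using (applyUpTo-∷ʳ; length-applyUpTo; ∷ʳ-++)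
open import Data.List.Relation.Unary.All as All using (All; []; _∷_; universal)
open import Data.List.Relation.Unary.All.Properties using (map⁺; applyUpTo⁺₂)
open import Data.Product using (_,_; proj₁)
open import Data.Sum using (inj₁; inj₂)
open import Relation.Nullary using (Irrelevant; yes; no; contradiction)
open import Relation.Binary.Definitions using (tri<; tri≈; tri>)
open import Relation.Binary.PropositionalEquality using (_≡_; _≢_; refl; sym; trans; cong; cong₂; subst; module ≡-Reasoning)
open import Function.Bundles using (_⤖_; _↔_; mk↔ₛ′)
open import Function.Properties.Inverse using (↔⇒⤖)

Step-irrelevant : ∀ {p a b} → Irrelevant (Step p a b)
Step-irrelevant (down 2≤a a≤p) (down 2≤a′ a≤p′) = cong₂ down (≤-irrelevant 2≤a 2≤a′) (≤-irrelevant a≤p a≤p′)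
Step-irrelevant (reset 1≤a a≤p) (reset 1≤a′ a≤p′) = cong₂ reset (≤-irrelevant 1≤a 1≤a′) (≤-irrelevant a≤p a≤p′)
Step-irrelevant (down (s≤s (s≤s z≤n)) a≤p) (reset _ _) = contradiction a≤p (n≮n _)
Step-irrelevant (reset _ _) (down (s≤s (s≤s z≤n)) a≤p) = contradiction a≤p (n≮n _)

Chain-irrelevant : ∀ {p w} → Irrelevant (Chain p w)
Chain-irrelevant single single = refl
Chain-irrelevant (cons s c) (cons s′ c′) = cong₂ cons (Step-irrelevant s s′) (Chain-irrelevant c c′)

PFib-irrelevant : ∀ {p w} → Irrelevant (PFib p w)
PFib-irrelevant (pfib c) (pfib c′) = cong pfib (Chain-irrelevant c c′)

below : ℕ → ℕ → List ℕ
below a k = applyUpTo (λ j → a ∸ suc j) k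

double-sum-descent : ∀ d e → 2 * sum (d + e ∷ below (d + e) d) ≡ (d + e + e) * suc d
double-sum-descent zero e = base e
  where
  base : ∀ e → 2 * (e + 0) ≡ (e + e) * 1
  base = solve-∀
double-sum-descent (suc d) e = begin
  2 * (suc d + e + sum (d + e ∷ below (d + e) d))      ≡⟨ *-distribˡ-+ 2 (suc d + e) _ ⟩
  2 * (suc d + e) + 2 * sum (d + e ∷ below (d + e) d)  ≡⟨ cong (2 * (suc d + e) +_) (double-sum-descent d e) ⟩
  2 * (suc d + e) + (d + e + e) * suc d                ≡⟨ step d e ⟩
  (suc d + e + e) * suc (suc d)                        ∎
  where
  open ≡-Reasoning
  step : ∀ d e → 2 * (suc d + e) + (d + e + e) * suc d ≡ (suc d + e + e) * suc (suc d)
  step = solve-∀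

module _ (p : ℕ) where

  block : ℕ → List ℕ
  block k = p ∷ below p k

  word : List ℕ → List ℕ
  word = concatMap block

  part : ℕ → ℕ
  part k = sum (block k)

  block-suc : ∀ k → block (suc k) ≡ block k ∷ʳ (p ∸ suc k)
  block-suc k = cong (p ∷_) (sym (applyUpTo-∷ʳ (λ j → p ∸ suc j) k))

  sum-word : ∀ ds → sum (word ds) ≡ sum (map part ds)
  sum-word []       = refl
  sum-word (d ∷ ds) = trans (sum-++ (block d) (word ds)) (cong (part d +_) (sum-word ds))

  -- k is the depth reached so far by the current block.
  depths : ℕ → List ℕ → List ℕ
  depths k []      = k ∷ []
  depths k (b ∷ w) with b ≟ p
  ... | yes _ = k ∷ depths 0 w
  ... | no  _ = depths (suc k) w

  parse : List ℕ → List ℕ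
  parse []      = []
  parse (_ ∷ w) = depths 0 w

  depths-reset : ∀ k w → depths k (p ∷ w) ≡ k ∷ depths 0 w
  depths-reset k w with p ≟ p
  ... | yes _   = refl
  ... | no  p≢p = contradiction refl p≢p

  depths-descend : ∀ {b} k w → b ≢ p → depths k (b ∷ w) ≡ depths (suc k) w
  depths-descend {b} k w b≢p with b ≟ p
  ... | yes b≡p = contradiction b≡p b≢p
  ... | no  _   = refl

  depths-++ : ∀ {xs} k ys → All (_≢ p) xs → depths k (xs ++ ys) ≡ depths (length xs + k) ys
  depths-++ k ys [] = refl
  depths-++ {x ∷ xs} k ys (x≢p ∷ xs≢p) = begin
    depths k (x ∷ xs ++ ys)        ≡⟨ depths-descend k (xs ++ ys) x≢p ⟩
    depths (suc k) (xs ++ ys)      ≡⟨ depths-++ (suc k) ys xs≢p ⟩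
    depths (length xs + suc k) ys  ≡⟨ cong (λ j → depths j ys) (+-suc (length xs) k) ⟩
    depths (suc (length xs) + k) ys ∎
    where open ≡-Reasoning

  depths-word : ∀ k ds → depths k (word ds) ≡ k ∷ parse (word ds)
  depths-word k []       = refl
  depths-word k (d ∷ ds) = depths-reset k (below p d ++ word ds)

  below-≢ : 0 < p → ∀ d → All (_≢ p) (below p d)
  below-≢ 0<p d = applyUpTo⁺₂ (λ j → p ∸ suc j) d (λ j → <⇒≢ (∸-suc-< 0<p j))
    where
    ∸-suc-< : ∀ {m} → 0 < m → ∀ j → m ∸ suc j < m
    ∸-suc-< {suc m} _ j = s≤s (m∸n≤m m j)

  parse-word : 0 < p → ∀ ds → parse (word ds) ≡ ds
  parse-word 0<p []       = refl
  parse-word 0<p (d ∷ ds) = begin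
    depths 0 (below p d ++ word ds)            ≡⟨ depths-++ 0 (word ds) (below-≢ 0<p d) ⟩
    depths (length (below p d) + 0) (word ds)  ≡⟨ cong (λ j → depths j (word ds)) length-below ⟩
    depths d (word ds)                         ≡⟨ depths-word d ds ⟩
    d ∷ parse (word ds)                        ≡⟨ cong (d ∷_) (parse-word 0<p ds) ⟩
    d ∷ ds                                     ∎
    where
    open ≡-Reasoning
    length-below : length (below p d) + 0 ≡ d
    length-below = trans (+-identityʳ _) (length-applyUpTo _ d)

  data StepFrom (k : ℕ) : ℕ → Set where
    reset   : StepFrom k p
    descend : suc k < p → StepFrom k (p ∸ suc k)

  stepFrom : ∀ {k b} → Step p (p ∸ k) b → StepFrom k b
  stepFrom (reset _ _) = reset
  stepFrom {k} (down 2≤p∸k _) = subst (StepFrom k) (sym (pred[m∸n]≡m∸[1+n] p k)) (descend 2+k≤p)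
    where
    k≤p : k ≤ p
    k≤p = <⇒≤ (m∸n≢0⇒n<m (n>0⇒n≢0 (≤-trans (s≤s z≤n) 2≤p∸k)))
    2+k≤p : 2 + k ≤ p
    2+k≤p = m≤o∸n⇒m+n≤o 2 k≤p 2≤p∸k

  descend-≢ : ∀ {k} → suc k < p → p ∸ suc k ≢ p
  descend-≢ sk<p = <⇒≢ (∸-monoʳ-< (s≤s z≤n) (<⇒≤ sk<p))

  word-depths : ∀ {k w} → Chain p (p ∸ k ∷ w) → word (depths k w) ≡ block k ++ w
  word-depths single = refl
  word-depths {k} {b ∷ w} (cons s c) with stepFrom {k} s
  ... | reset = begin
    word (depths k (p ∷ w))        ≡⟨ cong word (depths-reset k w) ⟩
    block k ++ word (depths 0 w)   ≡⟨ cong (block k ++_) (word-depths {0} c) ⟩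
    block k ++ p ∷ w               ∎
    where open ≡-Reasoning
  ... | descend sk<p = begin
    word (depths k (p ∸ suc k ∷ w))  ≡⟨ cong word (depths-descend k w (descend-≢ sk<p)) ⟩
    word (depths (suc k) w)          ≡⟨ word-depths c ⟩
    block (suc k) ++ w               ≡⟨ cong (_++ w) (block-suc k) ⟩
    block k ∷ʳ (p ∸ suc k) ++ w      ≡⟨ ∷ʳ-++ (block k) (p ∸ suc k) w ⟩
    block k ++ p ∸ suc k ∷ w         ∎
    where open ≡-Reasoning

  depths-bounded : ∀ {k w} → Chain p (p ∸ k ∷ w) → k < p → All (_< p) (depths k w)
  depths-bounded single k<p = k<p ∷ []
  depths-bounded {k} {b ∷ w} (cons s c) k<p with stepFrom {k} s
  ... | reset rewrite depths-reset k w = k<p ∷ depths-bounded {0} c (≤-trans (s≤s z≤n) k<p)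
  ... | descend sk<p rewrite depths-descend k w (descend-≢ sk<p) = depths-bounded c sk<p

  word-parse : ∀ {u} → PFib p u → word (parse u) ≡ u
  word-parse (pfib c) = word-depths {0} c

  parse-bounded : 0 < p → ∀ {u} → PFib p u → All (_< p) (parse u)
  parse-bounded 0<p (pfib c) = depths-bounded {0} c 0<p

  descent-chain : ∀ {a} d ds → a ≤ p → d < a → All (_< p) ds → Chain p (a ∷ below a d ++ word ds)
  descent-chain zero [] _ _ _ = single
  descent-chain zero (d ∷ ds) a≤p 0<a (d<p ∷ ds<p) =
    cons (reset 0<a a≤p) (descent-chain d ds ≤-refl d<p ds<p)
  descent-chain {suc a} (suc d) ds a<p (s≤s d<a) ds<p =
    cons (down (s≤s (≤-trans (s≤s z≤n) d<a)) a<p) (descent-chain d ds (<⇒≤ a<p) d<a ds<p)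

  word-pfib : ∀ {ds} → All (_< p) ds → 0 < sum (word ds) → PFib p (word ds)
  word-pfib {[]}     []           ()
  word-pfib {d ∷ ds} (d<p ∷ ds<p) _ = pfib (descent-chain d ds ≤-refl d<p ds<p)

  part-suc : ∀ k → part (suc k) ≡ part k + (p ∸ suc k)
  part-suc k = begin
    sum (block (suc k))              ≡⟨ cong sum (block-suc k) ⟩
    sum (block k ∷ʳ (p ∸ suc k))     ≡⟨ sum-++ (block k) [ p ∸ suc k ] ⟩
    part k + (p ∸ suc k + 0)         ≡⟨ cong (part k +_) (+-identityʳ _) ⟩
    part k + (p ∸ suc k)             ∎
    where open ≡-Reasoning

  part-<-suc : ∀ {k} → suc k < p → part k < part (suc k)
  part-<-suc {k} sk<p = subst (part k <_) (sym (part-suc k)) (m<m+n (part k) (m<n⇒0<n∸m sk<p))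

  part-< : ∀ {k k′} → k < k′ → k′ < p → part k < part k′
  part-< {k} {suc k′} (s≤s k≤k′) k′<p with m≤n⇒m<n∨m≡n k≤k′
  ... | inj₁ k<k′ = <-trans (part-< k<k′ (<-trans (n<1+n k′) k′<p)) (part-<-suc k′<p)
  ... | inj₂ refl = part-<-suc k′<p

  part-injective : ∀ {k k′} → k < p → k′ < p → part k ≡ part k′ → k ≡ k′
  part-injective {k} {k′} k<p k′<p eq with <-cmp k k′
  ... | tri< k<k′ _ _ = contradiction eq (<⇒≢ (part-< k<k′ k′<p))
  ... | tri≈ _ k≡k′ _ = k≡k′
  ... | tri> _ _ k′<k = contradiction (sym eq) (<⇒≢ (part-< k′<k k<p))

  part-positive : 0 < p → ∀ k → 0 < part k
  part-positive 0<p k = ≤-trans 0<p (m≤m+n p _)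

  double-part : ∀ {i} → i ≤ p → 2 * part (p ∸ i) ≡ (p + i) * (p + 1 ∸ i)
  double-part {i} i≤p = begin
    2 * sum (p ∷ below p d)            ≡⟨ cong (λ a → 2 * sum (a ∷ below a d)) (sym d+i≡p) ⟩
    2 * sum (d + i ∷ below (d + i) d)  ≡⟨ double-sum-descent d i ⟩
    (d + i + i) * suc d                ≡⟨ cong₂ _*_ (cong (_+ i) d+i≡p) (sym p+1∸i≡1+d) ⟩
    (p + i) * (p + 1 ∸ i)              ∎
    where
    open ≡-Reasoning
    d = p ∸ i
    d+i≡p : d + i ≡ p
    d+i≡p = m∸n+n≡m i≤p
    p+1∸i≡1+d : p + 1 ∸ i ≡ suc d
    p+1∸i≡1+d = trans (+-∸-comm 1 i≤p) (+-comm d 1)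

  part-witness : ∀ {a i} → i ≤ p → 2 * a ≡ (p + i) * (p + 1 ∸ i) → part (p ∸ i) ≡ a
  part-witness {a} {i} i≤p 2a≡ = *-cancelˡ-≡ (part (p ∸ i)) a 2 (trans (double-part i≤p) (sym 2a≡))

  part-InA : ∀ {k} → k < p → InA p (part k)
  part-InA {k} k<p = p ∸ k , m<n⇒0<n∸m k<p , m∸n≤m p k ,
    subst (λ j → 2 * part j ≡ (p + (p ∸ k)) * (p + 1 ∸ (p ∸ k)))
          (m∸[m∸n]≡n (<⇒≤ k<p)) (double-part (m∸n≤m p k))

  InA-irrelevant : ∀ {a} → Irrelevant (InA p a)
  InA-irrelevant {a} (i , 1≤i , i≤p , e) (j , 1≤j , j≤p , e′)
    with ∸-cancelˡ-≡ i≤p j≤p (part-injective (∸-monoʳ-< 1≤i i≤p) (∸-monoʳ-< 1≤j j≤p)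
                                 (trans (part-witness {a} i≤p e) (sym (part-witness {a} j≤p e′))))
  ... | refl = cong (i ,_) (cong₂ _,_ (≤-irrelevant 1≤i 1≤j)
                              (cong₂ _,_ (≤-irrelevant i≤p j≤p) (≡-irrelevant e e′)))

  depthsOf : ∀ {σ} → All (InA p) σ → List ℕ
  depthsOf []              = []
  depthsOf ((i , _) ∷ ias) = p ∸ i ∷ depthsOf ias

  depthsOf-< : ∀ {σ} (ias : All (InA p) σ) → All (_< p) (depthsOf ias)
  depthsOf-< []                          = []
  depthsOf-< ((i , 1≤i , i≤p , _) ∷ ias) = ∸-monoʳ-< 1≤i i≤p ∷ depthsOf-< ias

  map-part-depthsOf : ∀ {σ} (ias : All (InA p) σ) → map part (depthsOf ias) ≡ σ
  map-part-depthsOf []                                 = refl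
  map-part-depthsOf {a ∷ _} ((i , _ , i≤p , 2a≡) ∷ ias) =
    cong₂ _∷_ (part-witness {a} i≤p 2a≡) (map-part-depthsOf ias)

  partsInA : ∀ {ds} → All (_< p) ds → All (InA p) (map part ds)
  partsInA ds<p = map⁺ (All.map part-InA ds<p)

  depthsOf-partsInA : ∀ {ds} (ds<p : All (_< p) ds) → depthsOf (partsInA ds<p) ≡ ds
  depthsOf-partsInA []           = refl
  depthsOf-partsInA (k<p ∷ ds<p) = cong₂ _∷_ (m∸[m∸n]≡n (<⇒≤ k<p)) (depthsOf-partsInA ds<p)

module _ (p n : ℕ) (0<p : 0 < p) (0<n : 0 < n) where

  toComposition : PFibPolyomino p n → APComposition p n
  toComposition (u , pf , u-sum) = map (part p) ds , (positive , partsInA p ds<p) , parts-sum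
    where
    ds = parse p u
    ds<p : All (_< p) ds
    ds<p = parse-bounded p 0<p pf
    positive : All (0 <_) (map (part p) ds)
    positive = map⁺ (universal (part-positive p 0<p) ds)
    parts-sum : sum (map (part p) ds) ≡ n
    parts-sum = trans (sym (sum-word p ds)) (trans (cong sum (word-parse p pf)) u-sum)

  fromComposition : APComposition p n → PFibPolyomino p n
  fromComposition (σ , (_ , ias) , σ-sum) =
    word p ds , word-pfib p (depthsOf-< p ias) (subst (0 <_) (sym word-sum) 0<n) , word-sum
    where
    ds = depthsOf p ias
    word-sum : sum (word p ds) ≡ n
    word-sum = trans (sum-word p ds) (trans (cong sum (map-part-depthsOf p ias)) σ-sum)

  PFibPolyomino-≡ : {x y : PFibPolyomino p n} → proj₁ x ≡ proj₁ y → x ≡ y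
  PFibPolyomino-≡ {u , pf , s} {.u , pf′ , s′} refl =
    cong₂ (λ pf s → u , pf , s) (PFib-irrelevant pf pf′) (≡-irrelevant s s′)

  APComposition-≡ : {x y : APComposition p n} → proj₁ x ≡ proj₁ y → x ≡ y
  APComposition-≡ {σ , (pos , ias) , s} {.σ , (pos′ , ias′) , s′} refl =
    cong₂ (λ h s → σ , h , s)
      (cong₂ _,_ (All.irrelevant ≤-irrelevant pos pos′)
                 (All.irrelevant (λ {a} → InA-irrelevant p {a}) ias ias′))
      (≡-irrelevant s s′)

  pfibPolyomino↔apComposition : PFibPolyomino p n ↔ APComposition p n
  pfibPolyomino↔apComposition = mk↔ₛ′ toComposition fromComposition to∘from from∘to
    where
    open ≡-Reasoning
    to∘from : ∀ y → toComposition (fromComposition y) ≡ y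
    to∘from (σ , (_ , ias) , _) = APComposition-≡ (begin
      map (part p) (parse p (word p (depthsOf p ias)))  ≡⟨ cong (map (part p)) (parse-word p 0<p (depthsOf p ias)) ⟩
      map (part p) (depthsOf p ias)                     ≡⟨ map-part-depthsOf p ias ⟩
      σ                                                 ∎)
    from∘to : ∀ x → fromComposition (toComposition x) ≡ x
    from∘to (u , pf , _) = PFibPolyomino-≡ (begin
      word p (depthsOf p (partsInA p ds<p))  ≡⟨ cong (word p) (depthsOf-partsInA p ds<p) ⟩
      word p (parse p u)                     ≡⟨ word-parse p pf ⟩
      u                                      ∎)
      where
      ds<p : All (_< p) (parse p u)
      ds<p = parse-bounded p 0<p pf

theorem2 : (p n : ℕ) → 1 ≤ p → 1 ≤ n → PFibPolyomino p n ⤖ APComposition p n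
theorem2 p n 1≤p 1≤n = ↔⇒⤖ (pfibPolyomino↔apComposition p n 1≤p 1≤n)
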